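{- Let $G$ be a finite graph, $M$ a module of $G$ with $|M|\ge 2$, and $S,S'$ independent sets of $G$ with $|S|=|S'|$ and $|M\cap(S\cup S')|\le 1$. Then for every $v\in M\setminus(S\cup S')$: $S\leftrightsquigarrow S'$ in $G$ if and only if $S\leftrightsquigarrow S'$ in $G-v$.
   Context: Token Sliding ($\mathsf{TS}$): for independent sets $S,S'$ of a graph $H$ with $|S|=|S'|$, write $S\leftrightarrow S'$ (in $H$) if $|S\triangle S'|=2$ and the two vertices of $S\triangle S'$ are adjacent in $H$. Write $S\leftrightsquigarrow S'$ in $H$ if there exist $\ell\ge 0$ and independent sets $S_0=S,\dots,S_\ell=S'$ of $H$ with $S_{i-1}\leftrightarrow S_i$ for all $i$. A module of $G=(V,E)$ is a set $M\subseteq V$ such that every vertex of $V\setminus M$ is adjacent to all or to none of the vertices of $M$. -}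

module Defs where

open import Data.Nat using (ℕ; _≤_)
open import Data.Fin using (Fin)
open import Data.Bool using (_xor_)
open import Data.Vec using (zipWith)
open import Data.Fin.Subset using (Subset; _∈_; _∉_; _⊆_; ∣_∣; ⊤; _-_)
open import Data.Product using (_×_)
open import Data.Sum using (_⊎_)
open import Relation.Nullary using (¬_; Dec)
open import Relation.Binary.PropositionalEquality using (_≡_; _≢_)
open import Relation.Binary.Construct.Closure.ReflexiveTransitive using (Star)

record Graph (n : ℕ) : Set₁ where
  field
    Adj     : Fin n → Fin n → Set
    adj?    : ∀ x y → Dec (Adj x y)
    sym     : ∀ {x y} → Adj x y → Adj y x
    irrefl  : ∀ {x} → ¬ Adj x x

open Graph public

_△_ : ∀ {n} → Subset n → Subset n → Subset n
S △ T = zipWith _xor_ S T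

module _ {n : ℕ} (G : Graph n) where

  -- We work in the induced subgraph G[W] for a vertex set W ⊆ V(G).
  -- G itself is G[⊤], and G - v is G[⊤ - v].

  Indep : Subset n → Subset n → Set
  Indep W S = S ⊆ W × (∀ x y → x ∈ S → y ∈ S → ¬ Adj G x y)

  Slide : Subset n → Subset n → Subset n → Set
  Slide W S T =
    Indep W S × Indep W T × ∣ S ∣ ≡ ∣ T ∣ × ∣ S △ T ∣ ≡ 2 ×
    (∀ x y → x ∈ S △ T → y ∈ S △ T → x ≢ y → Adj G x y)

  Reach : Subset n → Subset n → Subset n → Set
  Reach W S T = Indep W S × Star (Slide W) S T

  IsModule : Subset n → Set
  IsModule M = ∀ x → x ∉ M →
    (∀ m → m ∈ M → Adj G x m) ⊎ (∀ m → m ∈ M → ¬ Adj G x m)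

-- A sequence in G - v is one in G (reach-mono).  Conversely choose u ∈ M,
-- u ≢ v, such that M ∩ (S ∪ S′) ⊆ {u} (representative), and "collapse" every
-- set A to (A ∖ M) ∪ ({u} if A meets M).  Since M is a module, collapsing an
-- independent set yields an independent set of G - v, and S, S′ are fixed.
-- Along a sequence every set meets M at most once, and then one slide of G
-- collapses to no move (both tokens in M) or to a single slide of G - v, so
-- the whole sequence collapses to one in G - v.

module Submission where

open import Defs
open import Data.Nat using (ℕ; _≤_)
open import Data.Fin using (Fin)
open import Data.Fin.Subset using (Subset; _∈_; _∉_; ∣_∣; ⊤; _-_; _∩_; _∪_)
open import Relation.Binary.PropositionalEquality using (_≡_)
open import Function.Bundles using (_⇔_)

open import Data.Nat using (suc; _<_; z≤n; s≤s)
open import Data.Nat.Properties using (≤-trans; <-irrefl; suc-injective; n≮0)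
open import Data.Fin using (zero; suc)
open import Data.Fin.Properties using (_≟_)
open import Data.Fin.Subset using (inside; outside; _⊆_; _─_; ⁅_⁆; Nonempty; Empty)
  renaming (⊥ to ∅)
open import Data.Fin.Subset.Properties
  using ( _∈?_; nonempty?; ⊆-antisym; ∈⊤; ∉⊥; Empty-unique; ∣⊥∣≡0; ∣⁅x⁆∣≡1
        ; x∈⁅x⁆; x∈⁅y⁆⇒x≡y; x∈p∩q⁺; x∈p∩q⁻; x∈p∪q⁺; x∈p∪q⁻; p⊆p∪q; q⊆p∪q; p─⊥≡p; p─q⊆p
        ; x∈p∧x∉q⇒x∈p─q; x∈p∧x≢y⇒x∈p-y; x∈p⇒∣p-x∣<∣p∣; p⊆q⇒∣p∣≤∣q∣; p⊂q⇒∣p∣<∣q∣)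
open import Data.Vec using (_∷_; here; there)
open import Function using (_∘_)
open import Data.Product using (∃; ∃₂; _×_; _,_; proj₁; proj₂; swap)
open import Data.Sum using (_⊎_; inj₁; inj₂; [_,_]) renaming (map to ⊎-map)
open import Data.Empty using (⊥-elim)
open import Relation.Nullary using (¬_; Dec; yes; no; contradiction)
open import Relation.Nullary.Decidable using (decidable-stable)
open import Relation.Binary.PropositionalEquality
  using (_≢_; refl; trans; cong; subst; subst₂; module ≡-Reasoning)
  renaming (sym to ≡-sym)
open import Function.Bundles using (mk⇔)
open import Relation.Binary.Construct.Closure.ReflexiveTransitive
  using (Star; ε; _◅_; map)

private
  variable
    n : ℕ
    W W′ A B D M P X : Subset n
    p q v x y z : Fin n

x∈p─q⇒x∉q : ∀ (p q : Subset n) → x ∈ p ─ q → x ∉ q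
x∈p─q⇒x∉q (s ∷ p) (outside ∷ q) here ()
x∈p─q⇒x∉q (s ∷ p) (t ∷ q) (there x∈p─q) (there x∈q) = x∈p─q⇒x∉q p q x∈p─q x∈q

x∈p-y⁻ : x ∈ P - y → x ∈ P × x ≢ y
x∈p-y⁻ {P = P} {y = y} x∈P-y =
  p─q⊆p P ⁅ y ⁆ x∈P-y ,
  λ { refl → x∈p─q⇒x∉q P ⁅ y ⁆ x∈P-y (x∈⁅x⁆ y) }

∣p∣≡1+∣p-x∣ : ∀ (P : Subset n) → x ∈ P → ∣ P ∣ ≡ suc ∣ P - x ∣
∣p∣≡1+∣p-x∣ (inside ∷ P) here = cong suc (cong ∣_∣ (≡-sym (p─⊥≡p P)))
∣p∣≡1+∣p-x∣ (outside ∷ P) (there x∈P) = ∣p∣≡1+∣p-x∣ P x∈P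
∣p∣≡1+∣p-x∣ (inside ∷ P) (there x∈P) = cong suc (∣p∣≡1+∣p-x∣ P x∈P)

empty⇒∣p∣≡0 : ∀ {n} {P : Subset n} → Empty P → ∣ P ∣ ≡ 0
empty⇒∣p∣≡0 {n} empty = trans (cong ∣_∣ (Empty-unique empty)) (∣⊥∣≡0 n)

∣p∣≡1+k⇒nonempty : ∀ (P : Subset n) {k} → ∣ P ∣ ≡ suc k → Nonempty P
∣p∣≡1+k⇒nonempty P ∣P∣≡1+k with nonempty? P
... | yes ne = ne
... | no empty = contradiction (trans (≡-sym ∣P∣≡1+k) (empty⇒∣p∣≡0 empty)) λ ()

∣p∣≡0⇒x∉p : ∀ (P : Subset n) → ∣ P ∣ ≡ 0 → x ∉ P
∣p∣≡0⇒x∉p {x = x} P ∣P∣≡0 x∈P =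
  n≮0 (subst (∣ P - x ∣ <_) ∣P∣≡0 (x∈p⇒∣p-x∣<∣p∣ x∈P))

two-members⇒2≤∣p∣ : x ∈ P → y ∈ P → x ≢ y → 2 ≤ ∣ P ∣
two-members⇒2≤∣p∣ x∈P y∈P x≢y =
  ≤-trans (s≤s (s≤s z≤n))
    (≤-trans (s≤s (x∈p⇒∣p-x∣<∣p∣ (x∈p∧x≢y⇒x∈p-y y∈P (λ y≡x → x≢y (≡-sym y≡x)))))
             (x∈p⇒∣p-x∣<∣p∣ x∈P))

∣p∣≤1⇒p⊆⁅x⁆ : ∣ P ∣ ≤ 1 → x ∈ P → P ⊆ ⁅ x ⁆
∣p∣≤1⇒p⊆⁅x⁆ {x = x} ∣P∣≤1 x∈P {y} y∈P with y ≟ x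
... | yes refl = x∈⁅x⁆ x
... | no y≢x with ≤-trans (two-members⇒2≤∣p∣ y∈P x∈P y≢x) ∣P∣≤1
...   | s≤s ()

p⊆⁅x⁆⇒∣p∣≤1 : P ⊆ ⁅ x ⁆ → ∣ P ∣ ≤ 1
p⊆⁅x⁆⇒∣p∣≤1 {x = x} P⊆⁅x⁆ = subst (_ ≤_) (∣⁅x⁆∣≡1 x) (p⊆q⇒∣p∣≤∣q∣ P⊆⁅x⁆)

∩-monoʳ : ∀ (M : Subset n) → P ⊆ X → M ∩ P ⊆ M ∩ X
∩-monoʳ {P = P} M P⊆X z∈M∩P with x∈p∩q⁻ M P z∈M∩P
... | z∈M , z∈P = x∈p∩q⁺ (z∈M , P⊆X z∈P)

record IsPair (D : Subset n) (p q : Fin n) : Set where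
  field
    p≢q  : p ≢ q
    p∈D  : p ∈ D
    q∈D  : q ∈ D
    only : ∀ z → z ∈ D → z ≡ p ⊎ z ≡ q

pair-swap : IsPair D p q → IsPair D q p
pair-swap pair = record
  { p≢q = λ q≡p → p≢q (≡-sym q≡p) ; p∈D = q∈D ; q∈D = p∈D
  ; only = λ z z∈D → [ inj₂ , inj₁ ] (only z z∈D) }
  where open IsPair pair

∣D∣≡2⇒pair : ∣ D ∣ ≡ 2 → ∃₂ (IsPair D)
∣D∣≡2⇒pair {D = D} ∣D∣≡2 with ∣p∣≡1+k⇒nonempty D ∣D∣≡2
... | p , p∈D
  with ∣p∣≡1+k⇒nonempty (D - p) (suc-injective (trans (≡-sym (∣p∣≡1+∣p-x∣ D p∈D)) ∣D∣≡2))
...   | q , q∈D-p = p , q , record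
  { p≢q = λ p≡q → proj₂ (x∈p-y⁻ q∈D-p) (≡-sym p≡q)
  ; p∈D = p∈D ; q∈D = proj₁ (x∈p-y⁻ q∈D-p) ; only = only }
  where
  ∣D-p-q∣≡0 : ∣ D - p - q ∣ ≡ 0
  ∣D-p-q∣≡0 = suc-injective (suc-injective (begin
    suc (suc ∣ D - p - q ∣) ≡⟨ cong suc (≡-sym (∣p∣≡1+∣p-x∣ (D - p) q∈D-p)) ⟩
    suc ∣ D - p ∣           ≡⟨ ≡-sym (∣p∣≡1+∣p-x∣ D p∈D) ⟩
    ∣ D ∣                   ≡⟨ ∣D∣≡2 ⟩
    2                       ∎))
    where open ≡-Reasoning
  only : ∀ z → z ∈ D → z ≡ p ⊎ z ≡ q
  only z z∈D with z ≟ p | z ≟ q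
  ... | yes z≡p | _       = inj₁ z≡p
  ... | no _    | yes z≡q = inj₂ z≡q
  ... | no z≢p  | no z≢q  =
    contradiction (x∈p∧x≢y⇒x∈p-y (x∈p∧x≢y⇒x∈p-y z∈D z≢p) z≢q) (∣p∣≡0⇒x∉p (D - p - q) ∣D-p-q∣≡0)

pair⇒∣D∣≡2 : IsPair D p q → ∣ D ∣ ≡ 2
pair⇒∣D∣≡2 {D = D} {p = p} {q = q} pair = begin
  ∣ D ∣                   ≡⟨ ∣p∣≡1+∣p-x∣ D p∈D ⟩
  suc ∣ D - p ∣           ≡⟨ cong suc (∣p∣≡1+∣p-x∣ (D - p) q∈D-p) ⟩
  suc (suc ∣ D - p - q ∣) ≡⟨ cong (λ k → suc (suc k)) ∣D-p-q∣≡0 ⟩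
  2                       ∎
  where
  open ≡-Reasoning
  open IsPair pair
  q∈D-p = x∈p∧x≢y⇒x∈p-y q∈D (λ q≡p → p≢q (≡-sym q≡p))
  D-p-q-empty : Empty (D - p - q)
  D-p-q-empty (z , z∈D-p-q) with x∈p-y⁻ z∈D-p-q
  ... | z∈D-p , z≢q with x∈p-y⁻ z∈D-p
  ...   | z∈D , z≢p = [ z≢p , z≢q ] (only z z∈D)
  ∣D-p-q∣≡0 : ∣ D - p - q ∣ ≡ 0
  ∣D-p-q∣≡0 = empty⇒∣p∣≡0 D-p-q-empty

△⁻ : ∀ (A B : Subset n) → x ∈ A △ B → (x ∈ A × x ∉ B) ⊎ (x ∉ A × x ∈ B)
△⁻ (inside ∷ A) (outside ∷ B) here = inj₁ (here , λ ())
△⁻ (outside ∷ A) (inside ∷ B) here = inj₂ ((λ ()) , here)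
△⁻ (a ∷ A) (b ∷ B) (there x∈A△B) with △⁻ A B x∈A△B
... | inj₁ (x∈A , x∉B) = inj₁ (there x∈A , λ { (there x∈B) → x∉B x∈B })
... | inj₂ (x∉A , x∈B) = inj₂ ((λ { (there x∈A) → x∉A x∈A }) , there x∈B)

△⁺ : ∀ (A B : Subset n) → (x ∈ A × x ∉ B) ⊎ (x ∉ A × x ∈ B) → x ∈ A △ B
△⁺ (inside ∷ A) (inside ∷ B) (inj₁ (here , x∉B)) = contradiction here x∉B
△⁺ (inside ∷ A) (outside ∷ B) (inj₁ (here , x∉B)) = here
△⁺ (a ∷ A) (b ∷ B) (inj₁ (there x∈A , x∉B)) = there (△⁺ A B (inj₁ (x∈A , x∉B ∘ there)))
△⁺ (inside ∷ A) (inside ∷ B) (inj₂ (x∉A , here)) = contradiction here x∉A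
△⁺ (outside ∷ A) (inside ∷ B) (inj₂ (x∉A , here)) = here
△⁺ (a ∷ A) (b ∷ B) (inj₂ (x∉A , there x∈B)) = there (△⁺ A B (inj₂ (x∉A ∘ there , x∈B)))

△-comm : ∀ (A B : Subset n) → x ∈ A △ B → x ∈ B △ A
△-comm A B = △⁺ B A ∘ [ inj₂ ∘ swap , inj₁ ∘ swap ] ∘ △⁻ A B

∉△⇒agree : ∀ (A B : Subset n) → x ∉ A △ B → (x ∈ A → x ∈ B) × (x ∈ B → x ∈ A)
∉△⇒agree {x = x} A B x∉A△B =
  (λ x∈A → decidable-stable (x ∈? B) (λ x∉B → x∉A△B (△⁺ A B (inj₁ (x∈A , x∉B))))) ,
  (λ x∈B → decidable-stable (x ∈? A) (λ x∉A → x∉A△B (△⁺ A B (inj₂ (x∉A , x∈B)))))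

one-sided-△⇒∣B∣<∣A∣ : ∀ (A B : Subset n) → (∀ z → z ∈ A △ B → z ∈ A) →
                      x ∈ A △ B → ∣ B ∣ < ∣ A ∣
one-sided-△⇒∣B∣<∣A∣ {x = x} A B within-A x∈A△B =
  p⊂q⇒∣p∣<∣q∣ (B⊆A , x , within-A x x∈A△B , x∉B)
  where
  B⊆A : B ⊆ A
  B⊆A {z} z∈B = decidable-stable (z ∈? A) λ z∉A → z∉A (within-A z (△⁺ A B (inj₂ (z∉A , z∈B))))
  x∉B : x ∉ B
  x∉B = [ proj₂ , (λ (x∉A , _) → contradiction (within-A x x∈A△B) x∉A) ] (△⁻ A B x∈A△B)

pair⊆ : IsPair D p q → p ∈ P → q ∈ P → ∀ z → z ∈ D → z ∈ P
pair⊆ {P = P} pair p∈P q∈P z z∈D =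
  [ (λ z≡p → subst (_∈ P) (≡-sym z≡p) p∈P) , (λ z≡q → subst (_∈ P) (≡-sym z≡q) q∈P) ]
    (IsPair.only pair z z∈D)

AgreeOff : Subset n → Subset n → Fin n → Fin n → Set
AgreeOff A B x y = ∀ z → z ≢ x → z ≢ y → (z ∈ A → z ∈ B) × (z ∈ B → z ∈ A)

record Exchange (A B : Subset n) (x y : Fin n) : Set where
  field
    x∈A   : x ∈ A
    x∉B   : x ∉ B
    y∉A   : y ∉ A
    y∈B   : y ∈ B
    agree : AgreeOff A B x y

exchange-flip : Exchange A B x y → Exchange B A y x
exchange-flip ex = record
  { x∈A = y∈B ; x∉B = y∉A ; y∉A = x∉B ; y∈B = x∈A
  ; agree = λ z z≢y z≢x → swap (agree z z≢x z≢y) }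
  where open Exchange ex

exchange-residue : Exchange A B x y → A - x ⊆ B - y
exchange-residue ex z∈A-x with x∈p-y⁻ z∈A-x
... | z∈A , z≢x = x∈p∧x≢y⇒x∈p-y (proj₁ (agree _ z≢x z≢y) z∈A) z≢y
  where
  open Exchange ex
  z≢y = λ { refl → y∉A z∈A }

exchange-△ : ∀ {A B : Subset n} → Exchange A B x y → IsPair (A △ B) x y
exchange-△ {x = x} {y = y} {A = A} {B = B} ex = record
  { p≢q = λ { refl → y∉A x∈A }
  ; p∈D = △⁺ A B (inj₁ (x∈A , x∉B))
  ; q∈D = △⁺ A B (inj₂ (y∉A , y∈B))
  ; only = only }
  where
  open Exchange ex
  only : ∀ z → z ∈ A △ B → z ≡ x ⊎ z ≡ y
  only z z∈A△B with z ≟ x | z ≟ y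
  ... | yes z≡x | _       = inj₁ z≡x
  ... | no _    | yes z≡y = inj₂ z≡y
  ... | no z≢x  | no z≢y  with agree z z≢x z≢y | △⁻ A B z∈A△B
  ...   | A⊆B , _ | inj₁ (z∈A , z∉B) = contradiction (A⊆B z∈A) z∉B
  ...   | _ , B⊆A | inj₂ (z∉A , z∈B) = contradiction (B⊆A z∈B) z∉A

pair⇒exchange : ∀ {A B : Subset n} → IsPair (A △ B) x y → x ∈ A → y ∈ B → Exchange A B x y
pair⇒exchange {A = A} {B = B} pair x∈A y∈B = record
  { x∈A = x∈A
  ; x∉B = [ proj₂ , (λ (x∉A , _) → contradiction x∈A x∉A) ] (△⁻ A B p∈D)
  ; y∉A = [ (λ (_ , y∉B) → contradiction y∈B y∉B) , proj₁ ] (△⁻ A B q∈D)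
  ; y∈B = y∈B
  ; agree = λ z z≢x z≢y → ∉△⇒agree A B λ z∈A△B → [ z≢x , z≢y ] (only z z∈A△B) }
  where open IsPair pair

exchange-meets : Exchange A B x y → M ∩ A ⊆ ⁅ x ⁆ → M ∩ B ⊆ ⁅ y ⁆
exchange-meets {A = A} {B = B} {x = x} {y = y} {M = M} ex M∩A⊆⁅x⁆ {z} z∈M∩B
  with x∈p∩q⁻ M B z∈M∩B | z ≟ y
... | _ , _ | yes refl = x∈⁅x⁆ y
... | z∈M , z∈B | no z≢y = contradiction (x∈⁅y⁆⇒x≡y x (M∩A⊆⁅x⁆ (x∈p∩q⁺ (z∈M , z∈A)))) z≢x
  where
  open Exchange ex
  z≢x : z ≢ x
  z≢x refl = x∉B z∈B
  z∈A = proj₂ (agree z z≢x z≢y) z∈B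

exchange-off-M : Exchange A B x y → x ∉ M → y ∉ M → M ∩ A ⊆ M ∩ B
exchange-off-M {A = A} {M = M} ex x∉M y∉M z∈M∩A with x∈p∩q⁻ M A z∈M∩A
... | z∈M , z∈A =
  x∈p∩q⁺ (z∈M , proj₁ (Exchange.agree ex _ (λ { refl → x∉M z∈M }) (λ { refl → y∉M z∈M })) z∈A)

representative : 2 ≤ ∣ M ∣ → ∣ M ∩ X ∣ ≤ 1 → v ∉ X → ∃ λ u → u ∈ M × u ≢ v × M ∩ X ⊆ ⁅ u ⁆
representative {M = M} {X = X} {v = v} 2≤∣M∣ ∣M∩X∣≤1 v∉X with nonempty? (M ∩ X)
... | yes (a , a∈M∩X) =
  a , proj₁ (x∈p∩q⁻ M X a∈M∩X) , (λ { refl → v∉X (proj₂ (x∈p∩q⁻ M X a∈M∩X)) }) ,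
  ∣p∣≤1⇒p⊆⁅x⁆ ∣M∩X∣≤1 a∈M∩X
... | no M∩X-empty with nonempty? (M - v)
...   | yes (u , u∈M-v) =
  u , proj₁ (x∈p-y⁻ u∈M-v) , proj₂ (x∈p-y⁻ u∈M-v) , λ z∈M∩X → ⊥-elim (M∩X-empty (_ , z∈M∩X))
...   | no M-v-empty with ≤-trans 2≤∣M∣ (p⊆⁅x⁆⇒∣p∣≤1 M⊆⁅v⁆)
  where
  M⊆⁅v⁆ : M ⊆ ⁅ v ⁆
  M⊆⁅v⁆ {z} z∈M with z ≟ v
  ... | yes refl = x∈⁅x⁆ v
  ... | no z≢v = ⊥-elim (M-v-empty (z , x∈p∧x≢y⇒x∈p-y z∈M z≢v))
...     | s≤s ()

module _ (G : Graph n) where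

  -- A slide exchanges a vertex x for an adjacent vertex y: if both points of
  -- A △ B lay on the same side, A and B would have different sizes.
  slide⇒exchange : Slide G W A B → ∃₂ λ x y → Exchange A B x y × Adj G x y
  slide⇒exchange {A = A} {B = B} (_ , _ , ∣A∣≡∣B∣ , ∣A△B∣≡2 , adjacent)
    with ∣D∣≡2⇒pair ∣A△B∣≡2
  ... | p , q , pair with △⁻ A B (IsPair.p∈D pair) | △⁻ A B (IsPair.q∈D pair)
  ...   | inj₁ (p∈A , _) | inj₂ (_ , q∈B) =
    p , q , pair⇒exchange pair p∈A q∈B , adjacent p q p∈D q∈D p≢q
    where open IsPair pair
  ...   | inj₂ (_ , p∈B) | inj₁ (q∈A , _) =
    q , p , pair⇒exchange (pair-swap pair) q∈A p∈B , adjacent q p q∈D p∈D (p≢q ∘ ≡-sym)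
    where open IsPair pair
  ...   | inj₁ (p∈A , _) | inj₁ (q∈A , _) =
    ⊥-elim (<-irrefl (≡-sym ∣A∣≡∣B∣)
      (one-sided-△⇒∣B∣<∣A∣ A B (pair⊆ pair p∈A q∈A) (IsPair.p∈D pair)))
  ...   | inj₂ (_ , p∈B) | inj₂ (_ , q∈B) =
    ⊥-elim (<-irrefl ∣A∣≡∣B∣ (one-sided-△⇒∣B∣<∣A∣ B A
      (λ z → pair⊆ pair p∈B q∈B z ∘ △-comm B A) (△-comm A B (IsPair.p∈D pair))))

  pair-adjacent : IsPair D x y → Adj G x y → ∀ z w → z ∈ D → w ∈ D → z ≢ w → Adj G z w
  pair-adjacent pair x~y z w z∈D w∈D z≢w with IsPair.only pair z z∈D | IsPair.only pair w w∈D
  ... | inj₁ refl | inj₁ refl = contradiction refl z≢w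
  ... | inj₁ refl | inj₂ refl = x~y
  ... | inj₂ refl | inj₁ refl = Graph.sym G x~y
  ... | inj₂ refl | inj₂ refl = contradiction refl z≢w

  exchange⇒slide : Indep G W A → Indep G W B → Exchange A B x y → Adj G x y → Slide G W A B
  exchange⇒slide {A = A} {B = B} {x = x} {y = y} IA IB ex x~y =
    IA , IB , ∣A∣≡∣B∣ , pair⇒∣D∣≡2 (exchange-△ ex) , pair-adjacent (exchange-△ ex) x~y
    where
    open Exchange ex
    open ≡-Reasoning
    ∣A∣≡∣B∣ : ∣ A ∣ ≡ ∣ B ∣
    ∣A∣≡∣B∣ = begin
      ∣ A ∣         ≡⟨ ∣p∣≡1+∣p-x∣ A x∈A ⟩
      suc ∣ A - x ∣ ≡⟨ cong (suc ∘ ∣_∣) (⊆-antisym (exchange-residue ex)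
                                                    (exchange-residue (exchange-flip ex))) ⟩
      suc ∣ B - y ∣ ≡⟨ ≡-sym (∣p∣≡1+∣p-x∣ B y∈B) ⟩
      ∣ B ∣         ∎

  indep-mono : W ⊆ W′ → Indep G W A → Indep G W′ A
  indep-mono W⊆W′ (A⊆W , independent) = W⊆W′ ∘ A⊆W , independent

  reach-mono : W ⊆ W′ → Reach G W A B → Reach G W′ A B
  reach-mono W⊆W′ (IA , path) =
    indep-mono W⊆W′ IA ,
    map (λ (IA , IB , rest) → indep-mono W⊆W′ IA , indep-mono W⊆W′ IB , rest) path

  module-adjacent : IsModule G M → x ∉ M → p ∈ M → q ∈ M → Adj G x p → Adj G x q
  module-adjacent isMod x∉M p∈M q∈M x~p with isMod _ x∉M
  ... | inj₁ adjacent-all  = adjacent-all _ q∈M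
  ... | inj₂ adjacent-none = contradiction x~p (adjacent-none _ p∈M)

  module Collapse {M : Subset n} (isMod : IsModule G M) {u v : Fin n}
                  (u∈M : u ∈ M) (v∈M : v ∈ M) (u≢v : u ≢ v) where

    Meets : Subset n → Set
    Meets A = Nonempty (M ∩ A)

    mark : ∀ {Q : Set} → Dec Q → Subset n
    mark (yes _) = ⁅ u ⁆
    mark (no _)  = ∅

    ∈mark⁻ : ∀ {Q : Set} (d : Dec Q) → z ∈ mark d → z ≡ u × Q
    ∈mark⁻ (yes q) z∈⁅u⁆ = x∈⁅y⁆⇒x≡y u z∈⁅u⁆ , q
    ∈mark⁻ (no _)  z∈∅   = contradiction z∈∅ ∉⊥

    ∈mark⁺ : ∀ {Q : Set} (d : Dec Q) → Q → u ∈ mark d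
    ∈mark⁺ (yes _) _ = x∈⁅x⁆ u
    ∈mark⁺ (no ¬q) q = contradiction q ¬q

    collapse : Subset n → Subset n
    collapse A = (A ─ M) ∪ mark (nonempty? (M ∩ A))

    ∈collapse⁻ : z ∈ collapse A → (z ∈ A × z ∉ M) ⊎ (z ≡ u × Meets A)
    ∈collapse⁻ {A = A} z∈ =
      ⊎-map (λ z∈A─M → p─q⊆p A M z∈A─M , x∈p─q⇒x∉q A M z∈A─M)
            (∈mark⁻ (nonempty? (M ∩ A)))
            (x∈p∪q⁻ (A ─ M) _ z∈)

    ∈collapse⁺ : (z ∈ A × z ∉ M) ⊎ (z ≡ u × Meets A) → z ∈ collapse A
    ∈collapse⁺ (inj₁ (z∈A , z∉M)) = x∈p∪q⁺ (inj₁ (x∈p∧x∉q⇒x∈p─q z∈A z∉M))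
    ∈collapse⁺ {A = A} (inj₂ (refl , meets)) =
      x∈p∪q⁺ (inj₂ (∈mark⁺ (nonempty? (M ∩ A)) meets))

    ∈collapse-outside : z ∉ M → z ∈ collapse A → z ∈ A
    ∈collapse-outside z∉M z∈ with ∈collapse⁻ z∈
    ... | inj₁ (z∈A , _) = z∈A
    ... | inj₂ (refl , _) = contradiction u∈M z∉M

    collapse-pointwise : (z ∉ M → z ∈ A → z ∈ B) → (z ≡ u → Meets A → Meets B) →
                         z ∈ collapse A → z ∈ collapse B
    collapse-pointwise off-M at-u z∈ =
      ∈collapse⁺ (⊎-map (λ (z∈A , z∉M) → off-M z∉M z∈A , z∉M)
                        (λ (z≡u , meets) → z≡u , at-u z≡u meets)
                        (∈collapse⁻ z∈))

    collapse-fix : M ∩ A ⊆ ⁅ u ⁆ → collapse A ≡ A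
    collapse-fix {A = A} M∩A⊆⁅u⁆ = ⊆-antisym collapse⊆A A⊆collapse
      where
      collapse⊆A : collapse A ⊆ A
      collapse⊆A z∈ with ∈collapse⁻ z∈
      ... | inj₁ (z∈A , _) = z∈A
      ... | inj₂ (refl , (m , m∈M∩A)) with x∈p∩q⁻ M A m∈M∩A
      ...   | _ , m∈A = subst (_∈ A) (x∈⁅y⁆⇒x≡y u (M∩A⊆⁅u⁆ m∈M∩A)) m∈A
      A⊆collapse : A ⊆ collapse A
      A⊆collapse {z} z∈A with z ∈? M
      ... | no z∉M = ∈collapse⁺ (inj₁ (z∈A , z∉M))
      ... | yes z∈M = ∈collapse⁺ (inj₂ ( x∈⁅y⁆⇒x≡y u (M∩A⊆⁅u⁆ (x∈p∩q⁺ (z∈M , z∈A)))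
                                        , z , x∈p∩q⁺ (z∈M , z∈A)))

    -- Collapsing keeps independence (u sees nothing of A outside M, since M
    -- is a module and A meets M) and avoids v.
    collapse-indep : Indep G ⊤ A → Indep G (⊤ - v) (collapse A)
    collapse-indep {A = A} (_ , independent) = avoids-v , independent′
      where
      avoids-v : collapse A ⊆ ⊤ - v
      avoids-v z∈ = x∈p∧x≢y⇒x∈p-y ∈⊤ (z≢v (∈collapse⁻ z∈))
        where
        z≢v : (_ ∈ A × _ ∉ M) ⊎ (_ ≡ u × Meets A) → _ ≢ v
        z≢v (inj₁ (_ , z∉M)) refl = z∉M v∈M
        z≢v (inj₂ (refl , _)) = u≢v
      u-unseen : x ∈ A → x ∉ M → Meets A → ¬ Adj G x u
      u-unseen x∈A x∉M (m , m∈M∩A) x~u with x∈p∩q⁻ M A m∈M∩A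
      ... | m∈M , m∈A = independent _ _ x∈A m∈A (module-adjacent isMod x∉M u∈M m∈M x~u)
      independent′ : ∀ x y → x ∈ collapse A → y ∈ collapse A → ¬ Adj G x y
      independent′ x y x∈ y∈ x~y with ∈collapse⁻ x∈ | ∈collapse⁻ y∈
      ... | inj₁ (x∈A , _)   | inj₁ (y∈A , _)   = independent x y x∈A y∈A x~y
      ... | inj₁ (x∈A , x∉M) | inj₂ (refl , m)  = u-unseen x∈A x∉M m x~y
      ... | inj₂ (refl , m)  | inj₁ (y∈A , y∉M) = u-unseen y∈A y∉M m (Graph.sym G x~y)
      ... | inj₂ (refl , _)  | inj₂ (refl , _)  = Graph.irrefl G x~y

    collapse-exchange-outside : Exchange A B x y → x ∉ M → y ∉ M →
                                Exchange (collapse A) (collapse B) x y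
    collapse-exchange-outside ex x∉M y∉M = record
      { x∈A = ∈collapse⁺ (inj₁ (x∈A , x∉M))
      ; x∉B = x∉B ∘ ∈collapse-outside x∉M
      ; y∉A = y∉A ∘ ∈collapse-outside y∉M
      ; y∈B = ∈collapse⁺ (inj₁ (y∈B , y∉M))
      ; agree = λ z z≢x z≢y →
          collapse-pointwise (λ _ → proj₁ (agree z z≢x z≢y))
                             (λ _ (m , m∈M∩A) → m , exchange-off-M ex x∉M y∉M m∈M∩A) ,
          collapse-pointwise (λ _ → proj₂ (agree z z≢x z≢y))
                             (λ _ (m , m∈M∩B) →
                               m , exchange-off-M (exchange-flip ex) y∉M x∉M m∈M∩B) }
      where open Exchange ex

    collapse-exchange-inside : Exchange A B x y → x ∈ M → y ∈ M → collapse A ⊆ collapse B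
    collapse-exchange-inside {y = y} ex x∈M y∈M =
      collapse-pointwise (λ z∉M → proj₁ (agree _ (λ { refl → z∉M x∈M }) (λ { refl → z∉M y∈M })))
                         (λ _ _ → y , x∈p∩q⁺ (y∈M , y∈B))
      where open Exchange ex

    collapse-exchange-leave : Exchange A B x y → x ∈ M → y ∉ M → ¬ Meets B →
                              Exchange (collapse A) (collapse B) u y
    collapse-exchange-leave {A = A} {B = B} {x = x} {y = y} ex x∈M y∉M B-misses-M = record
      { x∈A = ∈collapse⁺ (inj₂ (refl , x , x∈p∩q⁺ (x∈M , x∈A)))
      ; x∉B = [ (λ (_ , u∉M) → u∉M u∈M) , (λ (_ , meets) → B-misses-M meets) ] ∘ ∈collapse⁻
      ; y∉A = y∉A ∘ ∈collapse-outside y∉M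
      ; y∈B = ∈collapse⁺ (inj₁ (y∈B , y∉M))
      ; agree = λ z z≢u z≢y →
          collapse-pointwise (λ z∉M → proj₁ (agree z (λ { refl → z∉M x∈M }) z≢y))
                             (λ z≡u → contradiction z≡u z≢u) ,
          collapse-pointwise (λ z∉M → proj₂ (agree z (λ { refl → z∉M x∈M }) z≢y))
                             (λ z≡u → contradiction z≡u z≢u) }
      where open Exchange ex

    module _ {A B : Subset n} {x y : Fin n} (IA : Indep G ⊤ A) (IB : Indep G ⊤ B)
             (∣M∩A∣≤1 : ∣ M ∩ A ∣ ≤ 1) (ex : Exchange A B x y) (x~y : Adj G x y) where

      private
        M∩A⊆⁅x⁆ : x ∈ M → M ∩ A ⊆ ⁅ x ⁆
        M∩A⊆⁅x⁆ x∈M = ∣p∣≤1⇒p⊆⁅x⁆ ∣M∩A∣≤1 (x∈p∩q⁺ (x∈M , Exchange.x∈A ex))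

        collapsed-slide : Exchange (collapse A) (collapse B) p q → Adj G p q →
                          Slide G (⊤ - v) (collapse A) (collapse B)
        collapsed-slide = exchange⇒slide (collapse-indep IA) (collapse-indep IB)

      collapse-exchange-step :
        ∣ M ∩ B ∣ ≤ 1 × (collapse A ≡ collapse B ⊎ Slide G (⊤ - v) (collapse A) (collapse B))
      collapse-exchange-step with x ∈? M | y ∈? M
      ... | no x∉M | no y∉M =
        ≤-trans (p⊆q⇒∣p∣≤∣q∣ (exchange-off-M (exchange-flip ex) y∉M x∉M)) ∣M∩A∣≤1 ,
        inj₂ (collapsed-slide (collapse-exchange-outside ex x∉M y∉M) x~y)
      ... | yes x∈M | yes y∈M =
        p⊆⁅x⁆⇒∣p∣≤1 (exchange-meets ex (M∩A⊆⁅x⁆ x∈M)) ,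
        inj₁ (⊆-antisym (collapse-exchange-inside ex x∈M y∈M)
                        (collapse-exchange-inside (exchange-flip ex) y∈M x∈M))
      ... | yes x∈M | no y∉M =
        p⊆⁅x⁆⇒∣p∣≤1 M∩B⊆⁅y⁆ ,
        inj₂ (collapsed-slide (collapse-exchange-leave ex x∈M y∉M B-misses-M) u~y)
        where
        M∩B⊆⁅y⁆ = exchange-meets ex (M∩A⊆⁅x⁆ x∈M)
        B-misses-M : ¬ Meets B
        B-misses-M (m , m∈M∩B) with x∈⁅y⁆⇒x≡y y (M∩B⊆⁅y⁆ m∈M∩B)
        ... | refl = y∉M (proj₁ (x∈p∩q⁻ M B m∈M∩B))
        u~y = Graph.sym G (module-adjacent isMod y∉M x∈M u∈M (Graph.sym G x~y))
      ... | no x∉M | yes y∈M =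
        p⊆⁅x⁆⇒∣p∣≤1 (exchange-meets ex (λ z∈M∩A → ⊥-elim (A-misses-M (_ , z∈M∩A)))) ,
        inj₂ (collapsed-slide
               (exchange-flip (collapse-exchange-leave (exchange-flip ex) y∈M x∉M A-misses-M))
               (module-adjacent isMod x∉M y∈M u∈M x~y))
        where
        -- x sees y ∈ M, hence all of M, so the independent set A ∋ x misses M.
        A-misses-M : ¬ Meets A
        A-misses-M (m , m∈M∩A) with x∈p∩q⁻ M A m∈M∩A
        ... | m∈M , m∈A =
          proj₂ IA x m (Exchange.x∈A ex) m∈A (module-adjacent isMod x∉M y∈M m∈M x~y)

    collapse-path : Indep G ⊤ A → ∣ M ∩ A ∣ ≤ 1 → Star (Slide G ⊤) A B →
                    Star (Slide G (⊤ - v)) (collapse A) (collapse B)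
    collapse-path IA ∣M∩A∣≤1 ε = ε
    collapse-path IA ∣M∩A∣≤1 (sl@(_ , IC , _) ◅ path) with slide⇒exchange sl
    ... | _ , _ , ex , x~y with collapse-exchange-step IA IC ∣M∩A∣≤1 ex x~y
    ...   | ∣M∩C∣≤1 , inj₁ same =
      subst (λ C → Star _ C _) (≡-sym same) (collapse-path IC ∣M∩C∣≤1 path)
    ...   | ∣M∩C∣≤1 , inj₂ sl′ = sl′ ◅ collapse-path IC ∣M∩C∣≤1 path

lemma8 : ∀ {n} (G : Graph n) (M S S′ : Subset n) →
         IsModule G M → 2 ≤ ∣ M ∣ →
         Indep G ⊤ S → Indep G ⊤ S′ → ∣ S ∣ ≡ ∣ S′ ∣ →
         ∣ M ∩ (S ∪ S′) ∣ ≤ 1 →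
         ∀ (v : Fin n) → v ∈ M → v ∉ S ∪ S′ →
         (Reach G ⊤ S S′ ⇔ Reach G (⊤ - v) S S′)
-- Backwards, G - v is an induced subgraph of G.
lemma8 G M S S′ isMod 2≤∣M∣ _ _ _ ∣M∩[S∪S′]∣≤1 v v∈M v∉S∪S′
  with representative 2≤∣M∣ ∣M∩[S∪S′]∣≤1 v∉S∪S′
... | u , u∈M , u≢v , M∩[S∪S′]⊆⁅u⁆ = mk⇔ collapse-reach (reach-mono G λ _ → ∈⊤)
  where
  open Collapse G isMod u∈M v∈M u≢v
  M∩S⊆⁅u⁆ : M ∩ S ⊆ ⁅ u ⁆
  M∩S⊆⁅u⁆ = M∩[S∪S′]⊆⁅u⁆ ∘ ∩-monoʳ M (p⊆p∪q S′)
  M∩S′⊆⁅u⁆ : M ∩ S′ ⊆ ⁅ u ⁆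
  M∩S′⊆⁅u⁆ = M∩[S∪S′]⊆⁅u⁆ ∘ ∩-monoʳ M (q⊆p∪q S S′)
  -- S and S′ are fixed by the collapse, so a sequence in G collapses to one in G - v.
  collapse-reach : Reach G ⊤ S S′ → Reach G (⊤ - v) S S′
  collapse-reach (IS , path) =
    subst₂ (Reach G (⊤ - v)) (collapse-fix M∩S⊆⁅u⁆) (collapse-fix M∩S′⊆⁅u⁆)
      (collapse-indep IS , collapse-path IS (p⊆⁅x⁆⇒∣p∣≤1 M∩S⊆⁅u⁆) path)
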